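{- For all $n\in\mathbb{N}_0$, $\operatorname{inv}(n)\leq n-\log(n+1)$.
   Context: For a digraph $D$ and $X\subseteq V(D)$, inverting $X$ in $D$ means reversing the direction of every edge with both endpoints in $X$. A family $X_1,\dots,X_k\subseteq V(D)$ is a decycling family of $D$ if inverting $X_1,\dots,X_k$ in turn yields an acyclic digraph; $\operatorname{inv}(D)$ is the minimum size of a decycling family. For $n\in\mathbb{N}_0$, $\operatorname{inv}(n)$ denotes the maximum inversion number of an oriented graph (equivalently, a tournament) on $n$ vertices (so $\operatorname{inv}(0)=0$). Logarithms are base $2$. -}

module Defs where

open import Data.Nat using (ℕ; zero; suc; _+_; _*_; _^_; _≤_)
open import Data.Bool using (Bool; true; false; _∧_; if_then_else_)
open import Data.Fin using (Fin)
open import Data.Fin.Subset using (Subset)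
open import Data.Vec using (Vec; lookup; foldl)
open import Data.Product using (Σ; _×_)
open import Relation.Binary.PropositionalEquality using (_≡_)
open import Relation.Binary.Construct.Closure.Transitive using (TransClosure)
open import Relation.Nullary using (¬_)

Digraph : ℕ → Set
Digraph n = Fin n → Fin n → Bool

Arc : ∀ {n} → Digraph n → Fin n → Fin n → Set
Arc E u v = E u v ≡ true

Oriented : ∀ {n} → Digraph n → Set
Oriented {n} E = (∀ u → E u u ≡ false) × (∀ u v → E u v ≡ true → E v u ≡ false)

invert : ∀ {n} → Subset n → Digraph n → Digraph n
invert X E u v = if (lookup X u ∧ lookup X v) then E v u else E u v

invertAll : ∀ {n k} → Vec (Subset n) k → Digraph n → Digraph n
invertAll Xs E = foldl (λ _ → Digraph _) (λ D X → invert X D) E Xs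

Acyclic : ∀ {n} → Digraph n → Set
Acyclic {n} E = ∀ (u : Fin n) → ¬ TransClosure (Arc E) u u

IsDecycling : ∀ {n k} → Digraph n → Vec (Subset n) k → Set
IsDecycling E Xs = Acyclic (invertAll Xs E)

-- inv(D) ≤ k  (there is a decycling family of size k; sizes can be padded
-- with empty sets, so "size exactly k" is the same as "size at most k").
InvAtMost : ∀ {n} → Digraph n → ℕ → Set
InvAtMost {n} E k = Σ (Vec (Subset n) k) (IsDecycling E)

InvNAtMost : ℕ → ℕ → Set
InvNAtMost n k = ∀ (E : Digraph n) → Oriented E → InvAtMost E k

{-# OPTIONS --safe #-}
module Submission where

-- Take a vertex v of D[R], where |R| = m + 1, and (passing to the converse
-- digraph if needed) let its in-degree a be at most its out-degree, so 2a ≤ m.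
-- Inverting an in-neighbour u of v together with u's own in-neighbours in R
-- makes u a source without touching the arcs into v; after a such steps v is a
-- source too, and sources can be deleted at no cost.  Hence
-- inv(D[R]) ≤ a + inv(m - a), and (m - a + 1) 2^k ≤ 2^(m - a) with a ≤ m - a
-- gives (m + 2) 2^(a + k) ≤ 2^(m + 1).  The resulting k depends on D, so the
-- family is padded with empty sets up to the largest k the bound allows.

open import Defs
open import Data.Bool using (Bool; true; false; _∧_; _∨_; not; if_then_else_)
open import Data.Bool.Properties using (∧-comm; ∧-identityʳ; ∧-zeroʳ; ∧-commutativeMonoid)
open import Data.Empty using (⊥)
open import Data.Fin using (Fin; zero; suc)
open import Data.Fin.Properties using (_≟_)
open import Data.Fin.Subset using (Subset)
open import Data.Nat using (ℕ; zero; suc; _+_; _*_; _∸_; _^_; _≤_; _<_; _≤′_; ≤′-refl; ≤′-step; z≤n; s≤s; s≤s⁻¹; z<s; s<s; _≤?_)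
open import Data.Nat.Induction using (<-rec)
open import Data.Nat.Properties hiding (_≟_)
open import Data.Nat.Tactic.RingSolver using (solve-∀)
open import Data.Product using (Σ; _×_; _,_; proj₁; proj₂)
open import Data.Vec using (Vec; []; _∷_; lookup; tabulate; replicate)
open import Data.Vec.Properties using (lookup∘tabulate; lookup-replicate)
open import Data.Vec.Relation.Unary.All as All using (All; []; _∷_)
open import Function using (_∘_)
open import Relation.Binary.PropositionalEquality
open import Relation.Binary.Construct.Closure.Transitive using (TransClosure; [_]; _∷_)
open import Relation.Nullary using (¬_; yes; no; contradiction)
open import Relation.Nullary.Decidable using (⌊_⌋)
open import Relation.Unary using (Decidable)
open import Algebra.Bundles using (CommutativeMonoid)
open import Algebra.Properties.CommutativeSemigroup (CommutativeMonoid.commutativeSemigroup ∧-commutativeMonoid) using (xy∙z≈xz∙y)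

∧≡true⁻ : ∀ a b → a ∧ b ≡ true → a ≡ true × b ≡ true
∧≡true⁻ true true _ = refl , refl

_⊆_ : ∀ {n} → (Fin n → Bool) → (Fin n → Bool) → Set
R ⊆ S = ∀ i → R i ≡ true → S i ≡ true

_-_ : ∀ {n} → (Fin n → Bool) → Fin n → Fin n → Bool
(R - u) i = R i ∧ not ⌊ i ≟ u ⌋

R-u⊆R : ∀ {n} (R : Fin n → Bool) u → (R - u) ⊆ R
R-u⊆R R u i = proj₁ ∘ ∧≡true⁻ (R i) _

u∉R-u : ∀ {n} (R : Fin n → Bool) u → (R - u) u ≡ false
u∉R-u R u with u ≟ u
... | yes _ = ∧-zeroʳ (R u)
... | no u≢u = contradiction refl u≢u

⊆R-u⇒u∉ : ∀ {n} (R : Fin n → Bool) {u} (X : Fin n → Bool) → X ⊆ (R - u) → X u ≡ false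
⊆R-u⇒u∉ R {u} X X⊆R-u with X u in u∈X
... | true = trans (sym (X⊆R-u u u∈X)) (u∉R-u R u)
... | false = refl

≢⇒not≟ : ∀ {n} {w u : Fin n} → ¬ w ≡ u → not ⌊ w ≟ u ⌋ ≡ true
≢⇒not≟ {w = w} {u} w≢u with w ≟ u
... | yes w≡u = contradiction w≡u w≢u
... | no _ = refl

w∈R-u : ∀ {n} (R : Fin n → Bool) {u w} → R w ≡ true → ¬ w ≡ u → (R - u) w ≡ true
w∈R-u R rw w≢u rewrite rw = ≢⇒not≟ w≢u

remove-suc : ∀ {n} (R : Fin (suc n) → Bool) u i → (R - suc u) (suc i) ≡ ((R ∘ suc) - u) i
remove-suc R u i with i ≟ u
... | yes _ = refl
... | no _ = refl

bit : Bool → ℕ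
bit true = 1
bit false = 0

count : ∀ {n} → (Fin n → Bool) → ℕ
count {zero} R = 0
count {suc n} R = bit (R zero) + count (R ∘ suc)

count-cong : ∀ {n} {R S : Fin n → Bool} → (∀ i → R i ≡ S i) → count R ≡ count S
count-cong {zero} R≗S = refl
count-cong {suc n} R≗S = cong₂ _+_ (cong bit (R≗S zero)) (count-cong (R≗S ∘ suc))

count-mono : ∀ {n} {R S : Fin n → Bool} → R ⊆ S → count R ≤ count S
count-mono {zero} R⊆S = z≤n
count-mono {suc n} {R} {S} R⊆S = +-mono-≤ (bit-mono (R zero) (S zero) (R⊆S zero)) (count-mono (R⊆S ∘ suc))
  where
  bit-mono : ∀ a b → (a ≡ true → b ≡ true) → bit a ≤ bit b
  bit-mono true b a⇒b rewrite a⇒b refl = ≤-refl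
  bit-mono false b _ = z≤n

count-∨ : ∀ {n} (R S : Fin n → Bool) → (∀ i → R i ≡ true → S i ≡ true → ⊥) →
          count (λ i → R i ∨ S i) ≡ count R + count S
count-∨ {zero} R S disjoint = refl
count-∨ {suc n} R S disjoint with R zero | S zero | disjoint zero
... | true  | true  | disjoint₀ = contradiction refl (disjoint₀ refl)
... | true  | false | _ = cong suc (count-∨ (R ∘ suc) (S ∘ suc) (disjoint ∘ suc))
... | false | true  | _ = trans (cong suc (count-∨ (R ∘ suc) (S ∘ suc) (disjoint ∘ suc))) (sym (+-suc _ _))
... | false | false | _ = count-∨ (R ∘ suc) (S ∘ suc) (disjoint ∘ suc)

count≡0⇒empty : ∀ {n} (R : Fin n → Bool) → count R ≡ 0 → ∀ i → R i ≡ false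
count≡0⇒empty {suc n} R c i with R zero in r
count≡0⇒empty {suc n} R c zero    | false = r
count≡0⇒empty {suc n} R c (suc i) | false = count≡0⇒empty (R ∘ suc) c i

count≡suc⇒nonempty : ∀ {n m} (R : Fin n → Bool) → count R ≡ suc m → Σ (Fin n) λ i → R i ≡ true
count≡suc⇒nonempty {suc n} R c with R zero in r
... | true = zero , r
... | false = let i , ri = count≡suc⇒nonempty (R ∘ suc) c in suc i , ri

count-remove : ∀ {n} (R : Fin n → Bool) {u} → R u ≡ true → count R ≡ suc (count (R - u))
count-remove {suc n} R {zero} ru rewrite ru = cong suc (count-cong (sym ∘ ∧-identityʳ ∘ R ∘ suc))
count-remove {suc n} R {suc u} ru = begin
  bit (R zero) + count (R ∘ suc)                        ≡⟨ cong (bit (R zero) +_) (count-remove (R ∘ suc) ru) ⟩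
  bit (R zero) + suc (count ((R ∘ suc) - u))            ≡⟨ +-suc (bit (R zero)) _ ⟩
  suc (bit (R zero) + count ((R ∘ suc) - u))            ≡⟨ cong₂ (λ a c → suc (bit a + c))
                                                             (sym (∧-identityʳ (R zero))) (count-cong (sym ∘ remove-suc R u)) ⟩
  suc (bit (R zero ∧ true) + count ((R - suc u) ∘ suc)) ∎
  where open ≡-Reasoning

count-remove≡ : ∀ {n m} (R : Fin n → Bool) {u} → R u ≡ true → count R ≡ suc m → count (R - u) ≡ m
count-remove≡ R ru size = suc-injective (trans (sym (count-remove R ru)) size)

count-full : ∀ n → count {n} (λ _ → true) ≡ n
count-full zero = refl
count-full (suc n) = cong suc (count-full n)

converse : ∀ {n} → Digraph n → Digraph n
converse D u v = D v u

invertAll-converse : ∀ {n k} {D D' : Digraph n} → (∀ u v → D' u v ≡ D v u) →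
                     (Ys : Vec (Subset n) k) → ∀ u v → invertAll Ys D' u v ≡ invertAll Ys D v u
invertAll-converse D'≗D˘ [] = D'≗D˘
invertAll-converse {D = D} {D'} D'≗D˘ (X ∷ Ys) = invertAll-converse step Ys
  where
  step : ∀ u v → invert X D' u v ≡ invert X D v u
  step u v rewrite ∧-comm (lookup X v) (lookup X u) with lookup X u ∧ lookup X v
  ... | true = D'≗D˘ v u
  ... | false = D'≗D˘ u v

invertAll-cong : ∀ {n k} {D D' : Digraph n} → (∀ u v → D' u v ≡ D u v) →
                 (Ys : Vec (Subset n) k) → ∀ u v → invertAll Ys D' u v ≡ invertAll Ys D u v
invertAll-cong {D = D} D'≗D Ys u v =
  trans (invertAll-converse {D = converse D} D'≗D Ys u v) (invertAll-converse (λ _ _ → refl) Ys v u)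

invertAll-keeps-arcs-into : ∀ {n k} (D : Digraph n) (Ys : Vec (Subset n) k) {u} →
                            All (λ X → lookup X u ≡ false) Ys → ∀ w → invertAll Ys D w u ≡ D w u
invertAll-keeps-arcs-into D [] [] w = refl
invertAll-keeps-arcs-into D (X ∷ Ys) {u} (u∉X ∷ u∉Ys) w =
  trans (invertAll-keeps-arcs-into (invert X D) Ys u∉Ys w) invert-keeps
  where
  invert-keeps : invert X D w u ≡ D w u
  invert-keeps rewrite u∉X with lookup X w
  ... | true = refl
  ... | false = refl

invert-oriented : ∀ {n} (X : Subset n) {D : Digraph n} → Oriented D → Oriented (invert X D)
invert-oriented X {D} (loopless , antisymmetric) = loopless' , antisymmetric'
  where
  loopless' : ∀ u → invert X D u u ≡ false
  loopless' u with lookup X u ∧ lookup X u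
  ... | true = loopless u
  ... | false = loopless u
  antisymmetric' : ∀ u v → invert X D u v ≡ true → invert X D v u ≡ false
  antisymmetric' u v rewrite ∧-comm (lookup X v) (lookup X u) with lookup X u ∧ lookup X v
  ... | true = antisymmetric v u
  ... | false = antisymmetric u v

converse-oriented : ∀ {n} {D : Digraph n} → Oriented D → Oriented (converse D)
converse-oriented (loopless , antisymmetric) = loopless , λ u v → antisymmetric v u

acyclic-if-ranked : ∀ {n} {F : Digraph n} (rank : Fin n → ℕ) →
                    (∀ u v → F u v ≡ true → rank u < rank v) → Acyclic F
acyclic-if-ranked {F = F} rank increasing u cycle = <-irrefl refl (along cycle)
  where
  along : ∀ {v w} → TransClosure (Arc F) v w → rank v < rank w
  along [ vw ] = increasing _ _ vw
  along (vw ∷ walk) = <-trans (increasing _ _ vw) (along walk)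

-- A decycling family of D[R] inside R, certified by a ranking of R; the bound
-- `height` is what lets the ranking be flipped for the converse digraph.
record DecyclingOn {n} (D : Digraph n) (R : Fin n → Bool) (k : ℕ) : Set where
  field
    family      : Vec (Subset n) k
    family⊆R    : All (λ X → lookup X ⊆ R) family
    height      : ℕ
    rank        : Fin n → ℕ
    rank<height : ∀ w → R w ≡ true → rank w < height
    rank-mono   : ∀ w w' → R w ≡ true → R w' ≡ true →
                  invertAll family D w w' ≡ true → rank w < rank w'

open DecyclingOn

decyclingOn-empty : ∀ {n} {D : Digraph n} {R} → (∀ w → R w ≡ false) → DecyclingOn D R 0
decyclingOn-empty {R = R} R-empty = record
  { family = [] ; family⊆R = [] ; height = 0 ; rank = λ _ → 0
  ; rank<height = λ w → absurd w
  ; rank-mono = λ w _ rw → absurd w rw }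
  where
  absurd : ∀ {A : Set} w → R w ≡ true → A
  absurd w rw = contradiction (trans (sym (R-empty w)) rw) λ ()

decyclingOn-cong : ∀ {n k} {D D' : Digraph n} {R} → (∀ u v → D' u v ≡ D u v) →
                   DecyclingOn D R k → DecyclingOn D' R k
decyclingOn-cong D'≗D d = record
  { family = family d ; family⊆R = family⊆R d ; height = height d ; rank = rank d ; rank<height = rank<height d
  ; rank-mono = λ w w' rw rw' a → rank-mono d w w' rw rw' (trans (sym (invertAll-cong D'≗D (family d) w w')) a) }

decyclingOn-converse : ∀ {n k} {D : Digraph n} {R} → DecyclingOn (converse D) R k → DecyclingOn D R k
decyclingOn-converse {D = D} {R} d = record
  { family = family d ; family⊆R = family⊆R d ; height = height d ; rank = rank˘ ; rank<height = rank˘<height ; rank-mono = rank˘-mono }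
  where
  rank˘ : Fin _ → ℕ
  rank˘ w = height d ∸ suc (rank d w)
  rank˘<height : ∀ w → R w ≡ true → rank˘ w < height d
  rank˘<height w rw = ∸-monoʳ-< z<s (rank<height d w rw)
  rank˘-mono : ∀ w w' → R w ≡ true → R w' ≡ true → invertAll (family d) D w w' ≡ true → rank˘ w < rank˘ w'
  rank˘-mono w w' rw rw' a = ∸-monoʳ-< (s<s (rank-mono d w' w rw' rw
    (trans (invertAll-converse (λ _ _ → refl) (family d) w' w) a))) (rank<height d w rw)

decyclingOn-invert : ∀ {n k} {D : Digraph n} {R} (X : Subset n) → lookup X ⊆ R →
                     DecyclingOn (invert X D) R k → DecyclingOn D R (suc k)
decyclingOn-invert X X⊆R d = record
  { family = X ∷ family d ; family⊆R = X⊆R ∷ family⊆R d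
  ; height = height d ; rank = rank d ; rank<height = rank<height d ; rank-mono = rank-mono d }

decyclingOn-pad : ∀ {n k K} {D : Digraph n} {R} → k ≤ K → DecyclingOn D R k → DecyclingOn D R K
decyclingOn-pad {n} {D = D} {R} k≤K = pad (≤⇒≤′ k≤K)
  where
  ∅ : Subset n
  ∅ = replicate n false
  ∅⊆R : lookup ∅ ⊆ R
  ∅⊆R w w∈∅ = contradiction (trans (sym (lookup-replicate w false)) w∈∅) λ ()
  invert-∅ : ∀ u v → invert ∅ D u v ≡ D u v
  invert-∅ u v rewrite lookup-replicate u false = refl
  pad : ∀ {k K} → k ≤′ K → DecyclingOn D R k → DecyclingOn D R K
  pad ≤′-refl d = d
  pad (≤′-step k≤′K) d = decyclingOn-invert ∅ ∅⊆R (decyclingOn-cong invert-∅ (pad k≤′K d))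

Source : ∀ {n} → Digraph n → (Fin n → Bool) → Fin n → Set
Source D R u = ∀ w → R w ≡ true → D w u ≡ false

decyclingOn-source : ∀ {n k} {D : Digraph n} {R u} → R u ≡ true → Source D R u →
                     DecyclingOn D (R - u) k → DecyclingOn D R k
decyclingOn-source {D = D} {R} {u} ru source d = record
  { family = family d
  ; family⊆R = All.map (λ X⊆R-u w → R-u⊆R R u w ∘ X⊆R-u w) (family⊆R d)
  ; height = suc (height d) ; rank = rank⁺ ; rank<height = rank⁺<height ; rank-mono = rank⁺-mono }
  where
  u∉family : All (λ X → lookup X u ≡ false) (family d)
  u∉family = All.map (λ {X} → ⊆R-u⇒u∉ R (lookup X)) (family⊆R d)
  F = invertAll (family d) D
  arcs-into-u-kept : ∀ w → F w u ≡ D w u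
  arcs-into-u-kept = invertAll-keeps-arcs-into D (family d) u∉family
  rank⁺ : Fin _ → ℕ
  rank⁺ w = if ⌊ w ≟ u ⌋ then 0 else suc (rank d w)
  rank⁺<height : ∀ w → R w ≡ true → rank⁺ w < suc (height d)
  rank⁺<height w rw with w ≟ u
  ... | yes _ = z<s
  ... | no w≢u = s<s (rank<height d w (w∈R-u R rw w≢u))
  rank⁺-mono : ∀ w w' → R w ≡ true → R w' ≡ true → F w w' ≡ true → rank⁺ w < rank⁺ w'
  rank⁺-mono w w' rw rw' a with w ≟ u | w' ≟ u
  ... | _ | yes refl = contradiction (trans (sym (source w rw)) (trans (sym (arcs-into-u-kept w)) a)) λ ()
  ... | yes _ | no _ = z<s
  ... | no w≢u | no w'≢u = s<s (rank-mono d w w' (w∈R-u R rw w≢u) (w∈R-u R rw' w'≢u) a)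

sourcing : ∀ {n} → Digraph n → (Fin n → Bool) → Fin n → Subset n
sourcing D R u = tabulate (λ w → ⌊ w ≟ u ⌋ ∨ (R w ∧ D w u))

lookup-sourcing : ∀ {n} (D : Digraph n) R u w → lookup (sourcing D R u) w ≡ (⌊ w ≟ u ⌋ ∨ (R w ∧ D w u))
lookup-sourcing D R u = lookup∘tabulate _

sourcing⊆R : ∀ {n} (D : Digraph n) {R u} → R u ≡ true → lookup (sourcing D R u) ⊆ R
sourcing⊆R D {R} {u} ru w w∈X rewrite lookup-sourcing D R u w with w ≟ u
... | yes refl = ru
... | no _ = proj₁ (∧≡true⁻ (R w) _ w∈X)

sourcing-avoids : ∀ {n} {D : Digraph n} {R u v} → Oriented D → D u v ≡ true → lookup (sourcing D R u) v ≡ false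
sourcing-avoids {D = D} {R} {u} {v} (loopless , antisymmetric) uv rewrite lookup-sourcing D R u v with v ≟ u
... | yes refl = contradiction (trans (sym (loopless v)) uv) λ ()
... | no _ rewrite antisymmetric u v uv = ∧-zeroʳ (R v)

sourcing-source : ∀ {n} {D : Digraph n} {R u} → Oriented D → Source (invert (sourcing D R u) D) R u
sourcing-source {D = D} {R} {u} oriented w rw with w ≟ u in w≟u
... | yes refl = proj₁ (invert-oriented (sourcing D R u) oriented) w
... | no _ rewrite lookup-sourcing D R u w | lookup-sourcing D R u u | w≟u | rw with u ≟ u
... | no u≢u = contradiction refl u≢u
... | yes _ with D w u in wu
... | true = proj₂ oriented w u wu
... | false = refl

decyclingOn-makeSource : ∀ {n k} {D : Digraph n} {R u} → Oriented D → R u ≡ true →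
                         DecyclingOn (invert (sourcing D R u) D) (R - u) k → DecyclingOn D R (suc k)
decyclingOn-makeSource {D = D} {R} {u} oriented ru d =
  decyclingOn-invert (sourcing D R u) (sourcing⊆R D ru) (decyclingOn-source ru (sourcing-source oriented) d)

inNeighbours : ∀ {n} → Digraph n → (Fin n → Bool) → Fin n → Fin n → Bool
inNeighbours D R v w = R w ∧ D w v

inNeighbours-after-sourcing : ∀ {n} {D : Digraph n} {R u v} → Oriented D → D u v ≡ true →
  ∀ w → inNeighbours (invert (sourcing D R u) D) (R - u) v w ≡ (inNeighbours D R v - u) w
inNeighbours-after-sourcing {D = D} {R} {u} {v} oriented uv w = begin
  (R w ∧ not ⌊ w ≟ u ⌋) ∧ invert X D w v ≡⟨ cong ((R w ∧ not ⌊ w ≟ u ⌋) ∧_) (arcs-into-v-kept w) ⟩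
  (R w ∧ not ⌊ w ≟ u ⌋) ∧ D w v         ≡⟨ xy∙z≈xz∙y (R w) _ _ ⟩
  (R w ∧ D w v) ∧ not ⌊ w ≟ u ⌋         ∎
  where
  open ≡-Reasoning
  X = sourcing D R u
  arcs-into-v-kept = invertAll-keeps-arcs-into D (X ∷ []) (sourcing-avoids oriented uv ∷ [])

in+out≤ : ∀ {n m} {D : Digraph n} {R v} → Oriented D → R v ≡ true → count R ≡ suc m →
          count (inNeighbours D R v) + count (inNeighbours (converse D) R v) ≤ m
in+out≤ {m = m} {D} {R} {v} (loopless , antisymmetric) rv size = begin
  count (inNeighbours D R v) + count (inNeighbours (converse D) R v) ≡⟨ count-∨ _ _ disjoint ⟨
  count (λ w → inNeighbours D R v w ∨ inNeighbours (converse D) R v w) ≤⟨ count-mono neighbours⊆R-v ⟩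
  count (R - v)                                                          ≡⟨ count-remove≡ R rv size ⟩
  m                                                                      ∎
  where
  open ≤-Reasoning
  disjoint : ∀ w → inNeighbours D R v w ≡ true → inNeighbours (converse D) R v w ≡ true → ⊥
  disjoint w wv vw = contradiction (trans (sym (antisymmetric w v (proj₂ (∧≡true⁻ (R w) _ wv))))
                                          (proj₂ (∧≡true⁻ (R w) _ vw))) λ ()
  neighbours⊆R-v : (λ w → inNeighbours D R v w ∨ inNeighbours (converse D) R v w) ⊆ (R - v)
  neighbours⊆R-v w adjacent with R w | D w v in wv | D v w in vw
  ... | true | true  | _    = ≢⇒not≟ λ { refl → contradiction (trans (sym (loopless w)) wv) λ () }
  ... | true | false | true = ≢⇒not≟ λ { refl → contradiction (trans (sym (loopless w)) vw) λ () }

-- LogBound m k says k ≤ m - log (m + 1).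
LogBound : ℕ → ℕ → Set
LogBound m k = suc m * 2 ^ k ≤ 2 ^ m

logBound? : ∀ m → Decidable (LogBound m)
logBound? m k = suc m * 2 ^ k ≤? 2 ^ m

logBound-step : ∀ a m k → a ≤ m → LogBound m k → LogBound (suc (a + m)) (a + k)
logBound-step a m k a≤m bound = begin
  suc (suc (a + m)) * 2 ^ (a + k)  ≤⟨ *-monoˡ-≤ (2 ^ (a + k)) (s≤s (s≤s (+-monoˡ-≤ m a≤m))) ⟩
  (2 + (m + m)) * 2 ^ (a + k)      ≡⟨ cong ((2 + (m + m)) *_) (^-distribˡ-+-* 2 a k) ⟩
  (2 + (m + m)) * (2 ^ a * 2 ^ k)  ≡⟨ regroup m (2 ^ a) (2 ^ k) ⟩
  2 * 2 ^ a * (suc m * 2 ^ k)      ≤⟨ *-monoʳ-≤ (2 * 2 ^ a) bound ⟩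
  2 * 2 ^ a * 2 ^ m                ≡⟨ *-assoc 2 (2 ^ a) (2 ^ m) ⟩
  2 * (2 ^ a * 2 ^ m)              ≡⟨ cong (2 *_) (^-distribˡ-+-* 2 a m) ⟨
  2 ^ suc (a + m)                  ∎
  where
  open ≤-Reasoning
  regroup : ∀ m p q → (2 + (m + m)) * (p * q) ≡ 2 * p * (suc m * q)
  regroup = solve-∀

logBound-zero : ∀ m → LogBound m 0
logBound-zero zero = ≤-refl
logBound-zero (suc m) = logBound-step 0 m 0 z≤n (logBound-zero m)

logBound⇒≤ : ∀ m k → LogBound m k → k ≤ m
logBound⇒≤ m k bound = ≮⇒≥ λ m<k →
  <⇒≱ (^-monoʳ-< 2 (s≤s (s≤s z≤n)) m<k) (≤-trans (m≤n*m (2 ^ k) (suc m)) bound)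

greatest : ∀ {P : ℕ → Set} → Decidable P → P 0 → ∀ c → (∀ k → P k → k ≤ c) →
           Σ ℕ λ K → P K × (∀ k → P k → k ≤ K)
greatest P? P0 c ≤c with P? c
... | yes Pc = c , Pc , ≤c
greatest P? P0 zero    ≤c | no ¬P0 = contradiction P0 ¬P0
greatest P? P0 (suc c) ≤c | no ¬Pc =
  greatest P? P0 c λ k Pk → s≤s⁻¹ (≤∧≢⇒< (≤c k Pk) λ { refl → ¬Pc Pk })

Decyclable : ℕ → ℕ → Set
Decyclable n m = ∀ (D : Digraph n) R → Oriented D → count R ≡ m →
                 Σ ℕ λ k → LogBound m k × DecyclingOn D R k

clearInNeighbours : ∀ {n} m → Decyclable n m → ∀ j (D : Digraph n) R v → Oriented D → R v ≡ true →
                    count (inNeighbours D R v) ≡ j → count R ≡ suc (j + m) →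
                    Σ ℕ λ k → LogBound m k × DecyclingOn D R (j + k)
clearInNeighbours m solveRest zero D R v oriented rv indeg size =
  let k , bound , d = solveRest D (R - v) oriented (count-remove≡ R rv size)
  in  k , bound , decyclingOn-source rv v-source d
  where
  v-source : Source D R v
  v-source w rw with count≡0⇒empty (inNeighbours D R v) indeg w
  ... | wv rewrite rw = wv
clearInNeighbours m solveRest (suc j) D R v oriented rv indeg size =
  let k , bound , d = clearInNeighbours m solveRest j D' (R - u) v (invert-oriented X oriented)
                        (w∈R-u R rv v≢u) indeg' (count-remove≡ R ru size)
  in  k , bound , decyclingOn-makeSource oriented ru d
  where
  u∈in = count≡suc⇒nonempty (inNeighbours D R v) indeg
  u = proj₁ u∈in
  ru = proj₁ (∧≡true⁻ (R u) _ (proj₂ u∈in))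
  uv = proj₂ (∧≡true⁻ (R u) _ (proj₂ u∈in))
  X = sourcing D R u
  D' = invert X D
  v≢u : ¬ v ≡ u
  v≢u v≡u = contradiction (trans (sym (proj₁ oriented u)) (subst (λ x → D u x ≡ true) v≡u uv)) λ ()
  indeg' : count (inNeighbours D' (R - u) v) ≡ j
  indeg' = suc-injective (begin
    suc (count (inNeighbours D' (R - u) v))   ≡⟨ cong suc (count-cong (inNeighbours-after-sourcing oriented uv)) ⟩
    suc (count (inNeighbours D R v - u))      ≡⟨ count-remove (inNeighbours D R v) (proj₂ u∈in) ⟨
    count (inNeighbours D R v)                ≡⟨ indeg ⟩
    suc j                                     ∎)
    where open ≡-Reasoning

decyclable : ∀ {n} m → Decyclable n m
decyclable {n} = <-rec (Decyclable n) step
  where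
  viaSmallInDegree : ∀ {m a} → (∀ {m'} → m' < suc m → Decyclable n m') → ∀ (D : Digraph n) R v →
                     Oriented D → R v ≡ true → count R ≡ suc m →
                     count (inNeighbours D R v) ≡ a → a + a ≤ m →
                     Σ ℕ λ k → LogBound (suc m) k × DecyclingOn D R k
  viaSmallInDegree {a = a} rec D R v oriented rv size indeg 2a≤m
    with m' , refl ← m≤n⇒∃[o]m+o≡n (m+n≤o⇒m≤o a 2a≤m) =
    let a≤m' = +-cancelˡ-≤ a a m' 2a≤m
        k , bound , d = clearInNeighbours m' (rec (s≤s (m≤n+m m' a))) a D R v oriented rv indeg size
    in  a + k , logBound-step a m' k a≤m' bound , d
  step : ∀ m → (∀ {m'} → m' < m → Decyclable n m') → Decyclable n m
  step zero _ D R _ size = 0 , logBound-zero 0 , decyclingOn-empty (count≡0⇒empty R size)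
  step (suc m) rec D R oriented size with count≡suc⇒nonempty R size
  ... | v , rv with count (inNeighbours D R v) ≤? count (inNeighbours (converse D) R v)
  ... | yes in≤out = viaSmallInDegree rec D R v oriented rv size refl
                       (≤-trans (+-monoʳ-≤ _ in≤out) (in+out≤ oriented rv size))
  ... | no in≰out =
    let k , bound , d = viaSmallInDegree rec (converse D) R v (converse-oriented oriented) rv size refl
                          (≤-trans (+-monoˡ-≤ _ (<⇒≤ (≰⇒> in≰out))) (in+out≤ oriented rv size))
    in  k , bound , decyclingOn-converse d

decyclingOn-all⇒InvAtMost : ∀ {n k} {D : Digraph n} → DecyclingOn D (λ _ → true) k → InvAtMost D k
decyclingOn-all⇒InvAtMost d =
  family d , acyclic-if-ranked (rank d) (λ u v → rank-mono d u v refl refl)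

corollary7p3 : ∀ (n : ℕ) →
    Σ ℕ (λ k → (suc n * 2 ^ k ≤ 2 ^ n) × InvNAtMost n k)
corollary7p3 n =
  let K , bound-K , K-greatest = greatest (logBound? n) (logBound-zero n) n (logBound⇒≤ n)
  in  K , bound-K , λ D oriented →
        let k , bound-k , d = decyclable n D (λ _ → true) oriented (count-full n)
        in  decyclingOn-all⇒InvAtMost (decyclingOn-pad (K-greatest k bound-k) d)
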